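{- A finite binary word $w$ is a subword of $\mathbf{r}$ if and only if $w^R$ is a subword of $\mathbf{s}$. Moreover, let $t\geq 3$ be an integer and assume that $|w|\geq 2^t+1$ and $w$ is a subword of a $2^{t+1}$-aligned block of $\mathbf{r}$. If $w=r_n r_{n+1}\cdots r_{n+|w|-1}$ and $w^R=s_m s_{m+1}\cdots s_{m+|w|-1}$ for some integers $n,m\geq 0$, then $n+m+|w|\equiv 0 \pmod{2^{t+2}}$.
   Context: $\mathbf{r}=(r_n)_{n\geq0}$ with $r_n=e_{11}(n)\bmod 2$, where $e_{11}(n)$ is the number of (possibly overlapping) occurrences of $11$ in the binary expansion of $n$; $\mathbf{s}=(s_n)_{n\geq0}$ with $s_n=r_{2n+1}$. $w^R$ is the reversal of $w$. For an infinite word $\mathbf{u}=(u_n)_{n\geq 0}$ and $M\geq 1$, the $M$-aligned blocks of $\mathbf{u}$ are the words $u_{Mi}\cdots u_{M(i+1)-1}$, $i\in\mathbb{N}$. -}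

module Defs where

open import Data.Nat using (ℕ; zero; suc; _+_; _*_; _^_; _≤_; _/_; _%_)
open import Data.Bool using (Bool; true; false; _∧_; _xor_)
open import Data.List using (List; []; _∷_; length; reverse)
open import Data.Product using (∃; ∃-syntax; _×_)
open import Relation.Binary.PropositionalEquality using (_≡_)

bit : ℕ → ℕ → Bool
bit zero n = n % 2 Data.Nat.≡ᵇ 1
bit (suc i) n = bit i (n / 2)

count11 : ℕ → ℕ → ℕ
count11 zero n = zero
count11 (suc k) n with bit k n ∧ bit (suc k) n
... | true = suc (count11 k n)
... | false = count11 k n

-- e11(n): occurrences of 11 in the binary expansion of n
-- (all digits at positions ≥ n are 0, so positions i < n suffice)
e11 : ℕ → ℕ
e11 n = count11 n n

r : ℕ → Bool
r n = e11 n % 2 Data.Nat.≡ᵇ 1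

s : ℕ → Bool
s n = r (2 * n + 1)

factorAt : (ℕ → Bool) → ℕ → ℕ → List Bool
factorAt u n zero = []
factorAt u n (suc k) = u n ∷ factorAt u (suc n) k

OccursAt : (ℕ → Bool) → List Bool → ℕ → Set
OccursAt u w n = w ≡ factorAt u n (length w)

IsSubword : List Bool → (ℕ → Bool) → Set
IsSubword w u = ∃[ n ] OccursAt u w n

SubwordOfAlignedBlock : ℕ → List Bool → (ℕ → Bool) → Set
SubwordOfAlignedBlock M w u =
  ∃[ i ] ∃[ j ] ((j + length w ≤ M) × OccursAt u w (M * i + j))

{-# OPTIONS --safe #-}
-- Appending a binary digit e to x creates a new factor 11 exactly when e and the last digit of x
-- are 1, so r (e + 2x) = (e ∧ x odd) ⊕ r x.  Two consequences of this recurrence carry the proof.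
--
-- Reflection: if i + j + 1 = 2^(k+1) then r i = s j ⊕ (k mod 2) ⊕ bit k j.  For k of suitable
-- parity and a window in the right half of [0, 2^(k+1)) the correction vanishes, so factors of r
-- at n are reversed factors of s at m with n + m + |w| = 2^(k+1), and k may be taken as large as
-- we like.
--
-- Synchronisation: the difference sequence Δr p = r p ⊕ r (p + 1) satisfies Δr (2c) = c mod 2 and
-- Δr (2c + 1) = Δr c ⊕ c mod 2.  Hence agreement of Δr at two positions on 7 places forces equal
-- parity, and on 2^j places congruence modulo 2^(j+1).  An occurrence of w with |w| > 2^t is
-- therefore congruent modulo 2^(t+1) to the aligned one, and the block identity
-- r (2^(t+1) A + j) = r A ⊕ r j ⊕ (A mod 2 ∧ bit t j), read at the first and last letter of w,
-- fixes the next binary digit.  So all occurrences of w agree modulo 2^(t+2), in particular with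
-- the one produced by reflection, whose position sum is a multiple of 2^(t+2).

module Submission where

open import Data.Bool using (Bool; true; false; not; _∧_; _xor_)
open import Data.Bool.Properties
  using (xor-∧-commutativeRing; xor-comm; xor-assoc; xor-same; xor-identityʳ; ∧-zeroʳ; ∧-identityʳ; not-distribˡ-xor; not-¬)
open import Data.Empty using (⊥-elim)
open import Data.List using (List; []; _∷_; _∷ʳ_; length; reverse)
open import Data.List.Properties using (unfold-reverse; length-reverse; reverse-involutive; ∷-injective)
open import Data.Maybe using (just; nothing)
open import Data.Nat
  using (ℕ; zero; suc; _+_; _*_; _^_; _∸_; _≤_; _<_; _≤′_; ≤′-refl; ≤′-step; _/_; _%_; _≡ᵇ_; z≤n; s≤s; z<s; NonZero)
open import Data.Nat.DivMod
open import Data.Nat.Divisibility using (_∣_; divides; m%n≡0⇒n∣m; n∣m⇒m%n≡0)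
open import Data.Nat.Properties
open import Data.Nat.Tactic.RingSolver using (solve-∀)
open import Data.Product using (∃-syntax; _×_; _,_; proj₁; proj₂)
open import Function.Bundles using (_⇔_; mk⇔)
open import Level using (0ℓ)
open import Relation.Binary.PropositionalEquality
open import Relation.Nullary using (¬_)
open import Tactic.RingSolver.Core.AlmostCommutativeRing using (AlmostCommutativeRing; fromCommutativeRing)

open import Defs

open ≡-Reasoning

-- The zero test lets the solver cancel x ⊕ x, i.e. compute in characteristic 2.
xor-∧-ring : AlmostCommutativeRing 0ℓ 0ℓ
xor-∧-ring = fromCommutativeRing xor-∧-commutativeRing λ { false → just refl ; true → nothing }

open import Tactic.RingSolver.NonReflective xor-∧-ring using (solve; _⊜_; _⊕_; _⊗_; Κ)

xor-cancel : ∀ a c → (a xor c) xor c ≡ a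
xor-cancel a c = trans (xor-assoc a c c) (trans (cong (a xor_) (xor-same c)) (xor-identityʳ a))

xor-cancelʳ : ∀ {a b} c → a xor c ≡ b xor c → a ≡ b
xor-cancelʳ {a} {b} c eq = trans (sym (xor-cancel a c)) (trans (cong (_xor c) eq) (xor-cancel b c))

toℕ : Bool → ℕ
toℕ false = 0
toℕ true  = 1

toℕ≤1 : ∀ e → toℕ e ≤ 1
toℕ≤1 false = z≤n
toℕ≤1 true  = ≤-refl

oddᵇ : ℕ → Bool
oddᵇ zero    = false
oddᵇ (suc n) = not (oddᵇ n)

oddᵇ-toℕ : ∀ e → oddᵇ (toℕ e) ≡ e
oddᵇ-toℕ false = refl
oddᵇ-toℕ true  = refl

oddᵇ-+ : ∀ m n → oddᵇ (m + n) ≡ oddᵇ m xor oddᵇ n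
oddᵇ-+ zero    n = refl
oddᵇ-+ (suc m) n = trans (cong not (oddᵇ-+ m n)) (not-distribˡ-xor (oddᵇ m) (oddᵇ n))

oddᵇ-2* : ∀ x → oddᵇ (2 * x) ≡ false
oddᵇ-2* x = begin
  oddᵇ (x + (x + 0))        ≡⟨ oddᵇ-+ x (x + 0) ⟩
  oddᵇ x xor oddᵇ (x + 0)   ≡⟨ cong (λ y → oddᵇ x xor oddᵇ y) (+-identityʳ x) ⟩
  oddᵇ x xor oddᵇ x         ≡⟨ xor-same (oddᵇ x) ⟩
  false                     ∎

oddᵇ-2*-+ : ∀ x y → oddᵇ (2 * x + y) ≡ oddᵇ y
oddᵇ-2*-+ x y = trans (oddᵇ-+ (2 * x) y) (cong (_xor oddᵇ y) (oddᵇ-2* x))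

data Halving : ℕ → Set where
  digits : (e : Bool) (x : ℕ) → Halving (toℕ e + 2 * x)

halving : ∀ n → Halving n
halving zero = digits false 0
halving (suc n) with halving n
... | digits false x = digits true x
... | digits true  x = subst Halving (*-suc 2 x) (digits false (suc x))

oddᵇ-digits : ∀ e x → oddᵇ (toℕ e + 2 * x) ≡ e
oddᵇ-digits false x = oddᵇ-2* x
oddᵇ-digits true  x = cong not (oddᵇ-2* x)

half-digits : ∀ e x → (toℕ e + 2 * x) / 2 ≡ x
half-digits e x = begin
  (toℕ e + 2 * x) / 2     ≡⟨ +-distrib-/-∣ʳ (toℕ e) (divides x (*-comm 2 x)) ⟩
  toℕ e / 2 + 2 * x / 2   ≡⟨ cong₂ _+_ (toℕ/2 e) (trans (/-congˡ (*-comm 2 x)) (m*n/n≡m x 2)) ⟩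
  x                       ∎
  where
  toℕ/2 : ∀ e → toℕ e / 2 ≡ 0
  toℕ/2 false = refl
  toℕ/2 true  = refl

bit-zero-digits : ∀ e x → bit 0 (toℕ e + 2 * x) ≡ e
bit-zero-digits e x = begin
  (toℕ e + 2 * x) % 2 ≡ᵇ 1   ≡⟨ cong (λ y → (toℕ e + y) % 2 ≡ᵇ 1) (*-comm 2 x) ⟩
  (toℕ e + x * 2) % 2 ≡ᵇ 1   ≡⟨ cong (_≡ᵇ 1) ([m+kn]%n≡m%n (toℕ e) x 2) ⟩
  toℕ e % 2 ≡ᵇ 1             ≡⟨ toℕ%2 e ⟩
  e                          ∎
  where
  toℕ%2 : ∀ e → (toℕ e % 2 ≡ᵇ 1) ≡ e
  toℕ%2 false = refl
  toℕ%2 true  = refl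

bit-suc-digits : ∀ i e x → bit (suc i) (toℕ e + 2 * x) ≡ bit i x
bit-suc-digits i e x = cong (bit i) (half-digits e x)

bit-zero≡oddᵇ : ∀ n → bit 0 n ≡ oddᵇ n
bit-zero≡oddᵇ n with halving n
... | digits e x = trans (bit-zero-digits e x) (sym (oddᵇ-digits e x))

digits<2*suc : ∀ e x → toℕ e + 2 * x < 2 * suc x
digits<2*suc e x = subst (toℕ e + 2 * x <_) (sym (*-suc 2 x)) (lt e)
  where
  lt : ∀ e → toℕ e + 2 * x < 2 + 2 * x
  lt false = n≤1+n _
  lt true  = ≤-refl

digits<2*⇒< : ∀ e x M → toℕ e + 2 * x < 2 * M → x < M
digits<2*⇒< e x M lt = *-cancelˡ-< 2 x M (≤-<-trans (m≤n+m (2 * x) (toℕ e)) lt)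

2*≤digits⇒≤ : ∀ e x M → 2 * M ≤ toℕ e + 2 * x → M ≤ x
2*≤digits⇒≤ e x M le = ≤-pred (*-cancelˡ-< 2 M (suc x) (≤-<-trans le (digits<2*suc e x)))

n<2^n : ∀ n → n < 2 ^ n
n<2^n zero    = s≤s z≤n
n<2^n (suc n) = +-mono-≤ (m^n>0 2 n) (subst (suc n ≤_) (sym (+-identityʳ (2 ^ n))) (n<2^n n))

bit-< : ∀ k x → x < 2 ^ k → bit k x ≡ false
bit-< zero    zero    _        = refl
bit-< zero    (suc x) (s≤s ())
bit-< (suc k) x       lt with halving x
... | digits e y = trans (bit-suc-digits k e y) (bit-< k y (digits<2*⇒< e y (2 ^ k) lt))

bit-≥ : ∀ k x → 2 ^ k ≤ x → x < 2 ^ suc k → bit k x ≡ true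
bit-≥ zero    (suc zero)    _  _                = refl
bit-≥ zero    (suc (suc x)) _  (s≤s (s≤s ()))
bit-≥ (suc k) x             le lt with halving x
... | digits e y = trans (bit-suc-digits k e y)
                         (bit-≥ k y (2*≤digits⇒≤ e y (2 ^ k) le) (digits<2*⇒< e y (2 ^ suc k) lt))

count11-suc : ∀ k n → count11 (suc k) n ≡ toℕ (bit k n ∧ bit (suc k) n) + count11 k n
count11-suc k n with bit k n ∧ bit (suc k) n
... | true  = refl
... | false = refl

count11-stable : ∀ {n k} → n ≤ k → count11 k n ≡ e11 n
count11-stable {n} n≤k = go (≤⇒≤′ n≤k)
  where
  go : ∀ {k} → n ≤′ k → count11 k n ≡ e11 n
  go ≤′-refl = refl
  go (≤′-step {k} n≤′k) = begin
    count11 (suc k) n                                    ≡⟨ count11-suc k n ⟩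
    toℕ (bit k n ∧ bit (suc k) n) + count11 k n          ≡⟨ cong (λ b → toℕ (b ∧ bit (suc k) n) + count11 k n) beyond ⟩
    count11 k n                                          ≡⟨ go n≤′k ⟩
    e11 n                                                ∎
    where
    beyond : bit k n ≡ false
    beyond = bit-< k n (<-≤-trans (n<2^n n) (^-monoʳ-≤ 2 (≤′⇒≤ n≤′k)))

count11-halve : ∀ k n → count11 (suc k) n ≡ toℕ (bit 0 n ∧ bit 1 n) + count11 k (n / 2)
count11-halve zero    n = count11-suc 0 n
count11-halve (suc k) n = begin
  count11 (suc (suc k)) n                                  ≡⟨ count11-suc (suc k) n ⟩
  toℕ (bit k (n / 2) ∧ bit (suc k) (n / 2)) + count11 (suc k) n
    ≡⟨ cong (toℕ (bit k (n / 2) ∧ bit (suc k) (n / 2)) +_) (count11-halve k n) ⟩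
  toℕ (bit k (n / 2) ∧ bit (suc k) (n / 2)) + (toℕ (bit 0 n ∧ bit 1 n) + count11 k (n / 2))
    ≡⟨ +-comm-middle (toℕ (bit k (n / 2) ∧ bit (suc k) (n / 2))) (toℕ (bit 0 n ∧ bit 1 n)) _ ⟩
  toℕ (bit 0 n ∧ bit 1 n) + (toℕ (bit k (n / 2) ∧ bit (suc k) (n / 2)) + count11 k (n / 2))
    ≡⟨ cong (toℕ (bit 0 n ∧ bit 1 n) +_) (sym (count11-suc k (n / 2))) ⟩
  toℕ (bit 0 n ∧ bit 1 n) + count11 (suc k) (n / 2)        ∎
  where
  +-comm-middle : ∀ a b c → a + (b + c) ≡ b + (a + c)
  +-comm-middle = solve-∀

e11-digits : ∀ e x → e11 (toℕ e + 2 * x) ≡ toℕ (e ∧ oddᵇ x) + e11 x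
e11-digits e x = begin
  count11 n n                                  ≡⟨ count11-stable (n≤1+n n) ⟨
  count11 (suc n) n                            ≡⟨ count11-halve n n ⟩
  toℕ (bit 0 n ∧ bit 1 n) + count11 n (n / 2)  ≡⟨ cong₂ (λ a b → toℕ (a ∧ b) + count11 n (n / 2)) (bit-zero-digits e x) bit-one ⟩
  toℕ (e ∧ oddᵇ x) + count11 n (n / 2)         ≡⟨ cong (λ y → toℕ (e ∧ oddᵇ x) + count11 n y) (half-digits e x) ⟩
  toℕ (e ∧ oddᵇ x) + count11 n x               ≡⟨ cong (toℕ (e ∧ oddᵇ x) +_) (count11-stable x≤n) ⟩
  toℕ (e ∧ oddᵇ x) + e11 x                     ∎
  where
  n = toℕ e + 2 * x
  bit-one : bit 1 n ≡ oddᵇ x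
  bit-one = trans (bit-suc-digits 0 e x) (bit-zero≡oddᵇ x)
  x≤n : x ≤ n
  x≤n = ≤-trans (m≤m+n x (x + 0)) (m≤n+m (2 * x) (toℕ e))

r≡oddᵇ-e11 : ∀ n → r n ≡ oddᵇ (e11 n)
r≡oddᵇ-e11 n = bit-zero≡oddᵇ (e11 n)

r-digits : ∀ e x → r (toℕ e + 2 * x) ≡ (e ∧ oddᵇ x) xor r x
r-digits e x = begin
  r (toℕ e + 2 * x)                          ≡⟨ r≡oddᵇ-e11 (toℕ e + 2 * x) ⟩
  oddᵇ (e11 (toℕ e + 2 * x))                 ≡⟨ cong oddᵇ (e11-digits e x) ⟩
  oddᵇ (toℕ (e ∧ oddᵇ x) + e11 x)            ≡⟨ oddᵇ-+ (toℕ (e ∧ oddᵇ x)) (e11 x) ⟩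
  oddᵇ (toℕ (e ∧ oddᵇ x)) xor oddᵇ (e11 x)   ≡⟨ cong₂ _xor_ (oddᵇ-toℕ (e ∧ oddᵇ x)) (sym (r≡oddᵇ-e11 x)) ⟩
  (e ∧ oddᵇ x) xor r x                       ∎

s≡oddᵇ-xor-r : ∀ j → s j ≡ oddᵇ j xor r j
s≡oddᵇ-xor-r j = trans (cong r (+-comm (2 * j) 1)) (r-digits true j)

r-block : ∀ k A j → j < 2 ^ suc k → r (2 ^ suc k * A + j) ≡ (r A xor r j) xor (oddᵇ A ∧ bit k j)
r-block k A j lt with halving j
r-block zero A _ lt | digits e (suc y) with s≤s () ← digits<2*⇒< e (suc y) 1 lt
r-block zero A _ lt | digits e zero = begin
  r (2 * A + (toℕ e + 0))                      ≡⟨ cong r (+-comm (2 * A) (toℕ e + 0)) ⟩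
  r (toℕ e + 0 + 2 * A)                        ≡⟨ cong (λ a → r (a + 2 * A)) (+-identityʳ (toℕ e)) ⟩
  r (toℕ e + 2 * A)                            ≡⟨ r-digits e A ⟩
  (e ∧ oddᵇ A) xor r A                         ≡⟨ rearrange e (oddᵇ A) (r A) ⟩
  (r A xor ((e ∧ false) xor false)) xor (oddᵇ A ∧ e)
    ≡⟨ cong₂ (λ a b → (r A xor a) xor (oddᵇ A ∧ b)) (r-digits e 0) (bit-zero-digits e 0) ⟨
  (r A xor r (toℕ e + 2 * 0)) xor (oddᵇ A ∧ bit 0 (toℕ e + 2 * 0)) ∎
  where
  rearrange : ∀ e a ra → (e ∧ a) xor ra ≡ (ra xor ((e ∧ false) xor false)) xor (a ∧ e)
  rearrange = solve 3 (λ e a ra → ((e ⊗ a) ⊕ ra) ⊜ ((ra ⊕ ((e ⊗ Κ false) ⊕ Κ false)) ⊕ (a ⊗ e))) refl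
r-block (suc k) A _ lt | digits e y = begin
  r (2 ^ suc (suc k) * A + (toℕ e + 2 * y))                ≡⟨ cong r (carry (2 ^ suc k) A (toℕ e) y) ⟩
  r (toℕ e + 2 * (2 ^ suc k * A + y))                      ≡⟨ r-digits e (2 ^ suc k * A + y) ⟩
  (e ∧ oddᵇ (2 ^ suc k * A + y)) xor r (2 ^ suc k * A + y)
    ≡⟨ cong₂ (λ a b → (e ∧ a) xor b) block-parity (r-block k A y (digits<2*⇒< e y (2 ^ suc k) lt)) ⟩
  (e ∧ oddᵇ y) xor ((r A xor r y) xor (oddᵇ A ∧ bit k y))  ≡⟨ rearrange e (oddᵇ y) (r A) (r y) (oddᵇ A ∧ bit k y) ⟩
  (r A xor ((e ∧ oddᵇ y) xor r y)) xor (oddᵇ A ∧ bit k y)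
    ≡⟨ cong₂ (λ a b → (r A xor a) xor (oddᵇ A ∧ b)) (r-digits e y) (bit-suc-digits k e y) ⟨
  (r A xor r (toℕ e + 2 * y)) xor (oddᵇ A ∧ bit (suc k) (toℕ e + 2 * y)) ∎
  where
  carry : ∀ P A a y → 2 * P * A + (a + 2 * y) ≡ a + 2 * (P * A + y)
  carry = solve-∀
  block-parity : oddᵇ (2 ^ suc k * A + y) ≡ oddᵇ y
  block-parity = trans (cong (λ z → oddᵇ (z + y)) (*-assoc 2 (2 ^ k) A)) (oddᵇ-2*-+ (2 ^ k * A) y)
  rearrange : ∀ e oy ra ry c → (e ∧ oy) xor ((ra xor ry) xor c) ≡ (ra xor ((e ∧ oy) xor ry)) xor c
  rearrange = solve 5 (λ e oy ra ry c → ((e ⊗ oy) ⊕ ((ra ⊕ ry) ⊕ c)) ⊜ ((ra ⊕ ((e ⊗ oy) ⊕ ry)) ⊕ c)) refl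

odd≢even : ∀ x y → 1 + 2 * x ≢ 2 * y
odd≢even x y eq with () ← trans (sym (oddᵇ-digits true x)) (trans (cong oddᵇ eq) (oddᵇ-2* y))

oddᵇ-complement : ∀ i j {M} → suc (i + j) ≡ 2 * M → oddᵇ j ≡ not (oddᵇ i)
oddᵇ-complement i j {M} eq = begin
  oddᵇ j                                         ≡⟨ cancel (oddᵇ i) (oddᵇ j) ⟩
  not (oddᵇ i) xor not (oddᵇ i xor oddᵇ j)       ≡⟨ cong (λ b → not (oddᵇ i) xor not b) (oddᵇ-+ i j) ⟨
  not (oddᵇ i) xor oddᵇ (suc (i + j))            ≡⟨ cong (λ n → not (oddᵇ i) xor oddᵇ n) eq ⟩
  not (oddᵇ i) xor oddᵇ (2 * M)                  ≡⟨ cong (not (oddᵇ i) xor_) (oddᵇ-2* M) ⟩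
  not (oddᵇ i) xor false                         ≡⟨ xor-identityʳ (not (oddᵇ i)) ⟩
  not (oddᵇ i)                                   ∎
  where
  cancel : ∀ a b → b ≡ (true xor a) xor (true xor (a xor b))
  cancel = solve 2 (λ a b → b ⊜ ((Κ true ⊕ a) ⊕ (Κ true ⊕ (a ⊕ b)))) refl

complement-digits : ∀ a b x y M → suc ((toℕ a + 2 * x) + (toℕ b + 2 * y)) ≡ 2 * M
                  → b ≡ not a × suc (x + y) ≡ M
complement-digits false false x y M eq = ⊥-elim (odd≢even (x + y) M (trans (cong suc (*-distribˡ-+ 2 x y)) eq))
complement-digits true  true  x y M eq = ⊥-elim (odd≢even (suc (x + y)) M (trans (carry x y) eq))
  where
  carry : ∀ x y → 1 + 2 * suc (x + y) ≡ suc ((1 + 2 * x) + (1 + 2 * y))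
  carry = solve-∀
complement-digits false true  x y M eq = refl , *-cancelˡ-≡ (suc (x + y)) M 2 (trans (carry x y) eq)
  where
  carry : ∀ x y → 2 * suc (x + y) ≡ suc (2 * x + (1 + 2 * y))
  carry = solve-∀
complement-digits true  false x y M eq = refl , *-cancelˡ-≡ (suc (x + y)) M 2 (trans (carry x y) eq)
  where
  carry : ∀ x y → 2 * suc (x + y) ≡ suc ((1 + 2 * x) + 2 * y)
  carry = solve-∀

-- j is the complement of i in k + 1 binary digits: their last digits differ and their halves
-- are complementary in k digits.
r-reflect : ∀ k i j → suc (i + j) ≡ 2 ^ suc k → r i ≡ (s j xor oddᵇ k) xor bit k j
r-reflect zero    zero          (suc zero)    _  = refl
r-reflect zero    (suc zero)    zero          _  = refl
r-reflect zero    zero          zero          ()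
r-reflect zero    zero          (suc (suc j)) ()
r-reflect zero    (suc zero)    (suc j)       ()
r-reflect zero    (suc (suc i)) j             ()
r-reflect (suc k) i j eq with halving i | halving j
... | digits a i' | digits b j' with complement-digits a b i' j' (2 ^ suc k) eq
... | refl , eq' = begin
  r (toℕ a + 2 * i')                                         ≡⟨ r-digits a i' ⟩
  (a ∧ oddᵇ i') xor r i'                                     ≡⟨ cong ((a ∧ oddᵇ i') xor_) (r-reflect k i' j' eq') ⟩
  (a ∧ oddᵇ i') xor ((s j' xor oddᵇ k) xor bit k j')
    ≡⟨ cong (λ x → (a ∧ oddᵇ i') xor ((x xor oddᵇ k) xor bit k j')) (s≡oddᵇ-xor-r j') ⟩
  (a ∧ oddᵇ i') xor (((oddᵇ j' xor r j') xor oddᵇ k) xor bit k j')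
    ≡⟨ cong (λ o → (a ∧ oddᵇ i') xor (((o xor r j') xor oddᵇ k) xor bit k j')) (oddᵇ-complement i' j' {2 ^ k} eq') ⟩
  (a ∧ oddᵇ i') xor (((not (oddᵇ i') xor r j') xor oddᵇ k) xor bit k j')
    ≡⟨ rearrange a (oddᵇ i') (r j') (oddᵇ k) (bit k j') ⟩
  ((not a xor ((not a ∧ not (oddᵇ i')) xor r j')) xor not (oddᵇ k)) xor bit k j'
    ≡⟨ cong (λ o → ((not a xor ((not a ∧ o) xor r j')) xor not (oddᵇ k)) xor bit k j') (oddᵇ-complement i' j' {2 ^ k} eq') ⟨
  ((not a xor ((not a ∧ oddᵇ j') xor r j')) xor not (oddᵇ k)) xor bit k j'
    ≡⟨ cong₂ (λ x y → (x xor not (oddᵇ k)) xor y) s-digits (bit-suc-digits k (not a) j') ⟨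
  (s (toℕ (not a) + 2 * j') xor not (oddᵇ k)) xor bit (suc k) (toℕ (not a) + 2 * j') ∎
  where
  s-digits : s (toℕ (not a) + 2 * j') ≡ not a xor ((not a ∧ oddᵇ j') xor r j')
  s-digits = trans (s≡oddᵇ-xor-r (toℕ (not a) + 2 * j')) (cong₂ _xor_ (oddᵇ-digits (not a) j') (r-digits (not a) j'))
  rearrange : ∀ a oi rj ok bk → (a ∧ oi) xor ((((true xor oi) xor rj) xor ok) xor bk)
              ≡ (((true xor a) xor (((true xor a) ∧ (true xor oi)) xor rj)) xor (true xor ok)) xor bk
  rearrange = solve 5 (λ a oi rj ok bk →
    ((a ⊗ oi) ⊕ ((((Κ true ⊕ oi) ⊕ rj) ⊕ ok) ⊕ bk))
    ⊜ ((((Κ true ⊕ a) ⊕ (((Κ true ⊕ a) ⊗ (Κ true ⊕ oi)) ⊕ rj)) ⊕ (Κ true ⊕ ok)) ⊕ bk)) refl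

factorAt-∷ʳ : ∀ (u : ℕ → Bool) m L → factorAt u m (suc L) ≡ factorAt u m L ∷ʳ u (m + L)
factorAt-∷ʳ u m zero    = cong (λ k → u k ∷ []) (sym (+-identityʳ m))
factorAt-∷ʳ u m (suc L) =
  cong (u m ∷_) (trans (factorAt-∷ʳ u (suc m) L) (cong (λ k → factorAt u (suc m) L ∷ʳ u k) (sym (+-suc m L))))

reverse-factorAt : ∀ (u v : ℕ → Bool) n m L → (∀ i j → suc (i + j) ≡ L → u (n + i) ≡ v (m + j))
                 → reverse (factorAt u n L) ≡ factorAt v m L
reverse-factorAt u v n m zero    mirror = refl
reverse-factorAt u v n m (suc L) mirror = begin
  reverse (u n ∷ factorAt u (suc n) L)    ≡⟨ unfold-reverse (u n) (factorAt u (suc n) L) ⟩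
  reverse (factorAt u (suc n) L) ∷ʳ u n   ≡⟨ cong₂ _∷ʳ_ (reverse-factorAt u v (suc n) m L mirror′) first ⟩
  factorAt v m L ∷ʳ v (m + L)             ≡⟨ factorAt-∷ʳ v m L ⟨
  factorAt v m (suc L)                    ∎
  where
  first : u n ≡ v (m + L)
  first = trans (cong u (sym (+-identityʳ n))) (mirror 0 L refl)
  mirror′ : ∀ i j → suc (i + j) ≡ L → u (suc n + i) ≡ v (m + j)
  mirror′ i j eq = trans (cong u (sym (+-suc n i))) (mirror (suc i) j (cong suc eq))

1+i+j≡L⇒i<L : ∀ {i j L} → suc (i + j) ≡ L → i < L
1+i+j≡L⇒i<L {i} {j} eq = subst (i <_) eq (s≤s (m≤m+n i j))

1+i+j≡L⇒j<L : ∀ {i j L} → suc (i + j) ≡ L → j < L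
1+i+j≡L⇒j<L {i} {j} eq = subst (j <_) eq (s≤s (m≤n+m j i))

≤-complement : ∀ {a b M} → a + b ≡ M + M → a ≤ M → M ≤ b
≤-complement eq a≤M = ≮⇒≥ (λ b<M → <-irrefl eq (+-mono-≤-< a≤M b<M))

r≡s-low : ∀ k i j → oddᵇ k ≡ false → suc (i + j) ≡ 2 ^ suc k → j < 2 ^ k → r i ≡ s j
r≡s-low k i j even eq lt = begin
  r i                           ≡⟨ r-reflect k i j eq ⟩
  (s j xor oddᵇ k) xor bit k j  ≡⟨ cong₂ (λ a b → (s j xor a) xor b) even (bit-< k j lt) ⟩
  (s j xor false) xor false     ≡⟨ xor-cancel (s j) false ⟩
  s j                           ∎

r≡s-high : ∀ k i j → oddᵇ k ≡ true → suc (i + j) ≡ 2 ^ suc k → i < 2 ^ k → r i ≡ s j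
r≡s-high k i j odd eq lt = begin
  r i                           ≡⟨ r-reflect k i j eq ⟩
  (s j xor oddᵇ k) xor bit k j  ≡⟨ cong₂ (λ a b → (s j xor a) xor b) odd (bit-≥ k j high (1+i+j≡L⇒j<L eq)) ⟩
  (s j xor true) xor true       ≡⟨ xor-cancel (s j) true ⟩
  s j                           ∎
  where
  high : 2 ^ k ≤ j
  high = ≤-complement (trans eq (cong (2 ^ k +_) (+-identityʳ (2 ^ k)))) lt

mirrored-positions : ∀ n m {L T} i j → n + m + L ≡ T → suc (i + j) ≡ L → suc ((n + i) + (m + j)) ≡ T
mirrored-positions n m {L} {T} i j total eq = begin
  suc ((n + i) + (m + j))  ≡⟨ shuffle n m i j ⟩
  n + m + suc (i + j)      ≡⟨ cong (n + m +_) eq ⟩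
  n + m + L                ≡⟨ total ⟩
  T                        ∎
  where
  shuffle : ∀ n m i j → suc ((n + i) + (m + j)) ≡ n + m + suc (i + j)
  shuffle = solve-∀

n≤2^[2n] : ∀ x → x ≤ 2 ^ (2 * x)
n≤2^[2n] x = ≤-trans (<⇒≤ (n<2^n x)) (^-monoʳ-≤ 2 (m≤m+n x (x + 0)))

r-factor-in-s : ∀ n L → ∃[ m ] reverse (factorAt r n L) ≡ factorAt s m L
r-factor-in-s n L = m , reverse-factorAt r s n m L mirror
  where
  k = suc (2 * (n + L))
  n+L≤2^k : n + L ≤ 2 ^ k
  n+L≤2^k = ≤-trans (n≤2^[2n] (n + L)) (^-monoʳ-≤ 2 (n≤1+n (2 * (n + L))))
  m = 2 ^ suc k ∸ (n + L)
  total : n + m + L ≡ 2 ^ suc k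
  total = begin
    n + m + L      ≡⟨ rotate n m L ⟩
    m + (n + L)    ≡⟨ m∸n+n≡m (≤-trans n+L≤2^k (^-monoʳ-≤ 2 (n≤1+n k))) ⟩
    2 ^ suc k      ∎
    where
    rotate : ∀ n m L → n + m + L ≡ m + (n + L)
    rotate = solve-∀
  mirror : ∀ i j → suc (i + j) ≡ L → r (n + i) ≡ s (m + j)
  mirror i j eq = r≡s-high k (n + i) (m + j) (cong not (oddᵇ-2* (n + L))) (mirrored-positions n m i j total eq)
                    (<-≤-trans (+-monoʳ-< n (1+i+j≡L⇒i<L eq)) n+L≤2^k)

^-monoʳ-∣ : ∀ m {a b} → a ≤ b → m ^ a ∣ m ^ b
^-monoʳ-∣ m {a} {b} a≤b = divides (m ^ (b ∸ a)) (begin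
  m ^ b               ≡⟨ cong (m ^_) (m+[n∸m]≡n a≤b) ⟨
  m ^ (a + (b ∸ a))   ≡⟨ ^-distribˡ-+-* m a (b ∸ a) ⟩
  m ^ a * m ^ (b ∸ a) ≡⟨ *-comm (m ^ a) (m ^ (b ∸ a)) ⟩
  m ^ (b ∸ a) * m ^ a ∎)

s-factor-in-r : ∀ m L B → ∃[ n ] reverse (factorAt r n L) ≡ factorAt s m L × 2 ^ B ∣ n + m + L
s-factor-in-r m L B = n , reverse-factorAt r s n m L mirror , subst (2 ^ B ∣_) (sym total) (^-monoʳ-∣ 2 B≤1+k)
  where
  k = 2 * (B + (m + L))
  m+L≤2^k : m + L ≤ 2 ^ k
  m+L≤2^k = ≤-trans (m≤n+m (m + L) B) (n≤2^[2n] (B + (m + L)))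
  B≤1+k : B ≤ suc k
  B≤1+k = ≤-trans (m≤m+n B (m + L)) (≤-trans (m≤m+n _ _) (n≤1+n k))
  n = 2 ^ suc k ∸ (m + L)
  total : n + m + L ≡ 2 ^ suc k
  total = trans (+-assoc n m L) (m∸n+n≡m (≤-trans m+L≤2^k (^-monoʳ-≤ 2 (n≤1+n k))))
  mirror : ∀ i j → suc (i + j) ≡ L → r (n + i) ≡ s (m + j)
  mirror i j eq = r≡s-low k (n + i) (m + j) (oddᵇ-2* (B + (m + L))) (mirrored-positions n m i j total eq)
                    (<-≤-trans (+-monoʳ-< m (1+i+j≡L⇒j<L eq)) m+L≤2^k)

reverse-occurs : ∀ {u v w n m} → OccursAt u w n → reverse (factorAt u n (length w)) ≡ factorAt v m (length w)
               → OccursAt v (reverse w) m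
reverse-occurs {v = v} {w} {m = m} occ mirror =
  trans (cong reverse occ) (trans mirror (cong (factorAt v m) (sym (length-reverse w))))

reverse-occurs⁻¹ : ∀ {u v w n m} → OccursAt v (reverse w) m → reverse (factorAt u n (length w)) ≡ factorAt v m (length w)
                 → OccursAt u w n
reverse-occurs⁻¹ {u} {v} {w} {n} {m} occ mirror = begin
  w                                          ≡⟨ reverse-involutive w ⟨
  reverse (reverse w)                        ≡⟨ cong reverse (trans occ (cong (factorAt v m) (length-reverse w))) ⟩
  reverse (factorAt v m (length w))          ≡⟨ cong reverse mirror ⟨
  reverse (reverse (factorAt u n (length w))) ≡⟨ reverse-involutive _ ⟩
  factorAt u n (length w)                    ∎

subword-r⇔reverse-subword-s : ∀ w → IsSubword w r ⇔ IsSubword (reverse w) s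
subword-r⇔reverse-subword-s w = mk⇔ to from
  where
  to : IsSubword w r → IsSubword (reverse w) s
  to (n , occ) = let (m , mirror) = r-factor-in-s n (length w) in m , reverse-occurs occ mirror
  from : IsSubword (reverse w) s → IsSubword w r
  from (m , occ) = let (n , mirror , _) = s-factor-in-r m (length w) 0 in n , reverse-occurs⁻¹ occ mirror

record AgreeOn (u : ℕ → Bool) (L n n' : ℕ) : Set where
  constructor agreeing
  field
    at : ∀ i → i < L → u (n + i) ≡ u (n' + i)

open AgreeOn

agree-≤ : ∀ {u L L' n n'} → L' ≤ L → AgreeOn u L n n' → AgreeOn u L' n n'
agree-≤ L'≤L agree = agreeing λ i lt → at agree i (<-≤-trans lt L'≤L)

factorAt-agree : ∀ u n n' L → factorAt u n L ≡ factorAt u n' L → AgreeOn u L n n'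
factorAt-agree u n n' L eq = agreeing (pointwise n n' L eq)
  where
  pointwise : ∀ n n' L → factorAt u n L ≡ factorAt u n' L → ∀ i → i < L → u (n + i) ≡ u (n' + i)
  pointwise n n' (suc L) eq zero    _         =
    trans (cong u (+-identityʳ n)) (trans (proj₁ (∷-injective eq)) (cong u (sym (+-identityʳ n'))))
  pointwise n n' (suc L) eq (suc i) (s≤s i<L) =
    trans (cong u (+-suc n i)) (trans (pointwise (suc n) (suc n') L (proj₂ (∷-injective eq)) i i<L) (cong u (sym (+-suc n' i))))

occurrences-agree : ∀ {u w n n'} → OccursAt u w n → OccursAt u w n' → AgreeOn u (length w) n n'
occurrences-agree {u} {w} {n} {n'} occ occ' = factorAt-agree u n n' (length w) (trans (sym occ) occ')

Δ : (ℕ → Bool) → ℕ → Bool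
Δ u p = u p xor u (suc p)

agree-Δ : ∀ {u L n n'} → AgreeOn u (suc L) n n' → AgreeOn (Δ u) L n n'
agree-Δ {u} {L} {n} {n'} agree = agreeing λ i lt → cong₂ _xor_ (at agree i (<-trans lt (n<1+n L))) (begin
  u (suc (n + i))   ≡⟨ cong u (+-suc n i) ⟨
  u (n + suc i)     ≡⟨ at agree (suc i) (s≤s lt) ⟩
  u (n' + suc i)    ≡⟨ cong u (+-suc n' i) ⟩
  u (suc (n' + i))  ∎)

Δr-even : ∀ c → Δ r (2 * c) ≡ oddᵇ c
Δr-even c = trans (cong₂ _xor_ (r-digits false c) (r-digits true c)) (cancel (r c) (oddᵇ c))
  where
  cancel : ∀ a b → a xor (b xor a) ≡ b
  cancel = solve 2 (λ a b → (a ⊕ (b ⊕ a)) ⊜ b) refl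

Δr-odd : ∀ c → Δ r (suc (2 * c)) ≡ Δ r c xor oddᵇ c
Δr-odd c = begin
  r (suc (2 * c)) xor r (suc (suc (2 * c)))  ≡⟨ cong (λ n → r (suc (2 * c)) xor r n) (*-suc 2 c) ⟨
  r (suc (2 * c)) xor r (2 * suc c)          ≡⟨ cong₂ _xor_ (r-digits true c) (r-digits false (suc c)) ⟩
  (oddᵇ c xor r c) xor r (suc c)             ≡⟨ rearrange (oddᵇ c) (r c) (r (suc c)) ⟩
  (r c xor r (suc c)) xor oddᵇ c             ∎
  where
  rearrange : ∀ a b c → (a xor b) xor c ≡ (b xor c) xor a
  rearrange = solve 3 (λ a b c → ((a ⊕ b) ⊕ c) ⊜ ((b ⊕ c) ⊕ a)) refl

round-to-even : ∀ e x → (toℕ e + 2 * x) + toℕ e ≡ 2 * (x + toℕ e)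
round-to-even e x = shift (toℕ e) x
  where
  shift : ∀ a x → (a + 2 * x) + a ≡ 2 * (x + a)
  shift = solve-∀

Δr-flips : ∀ c → ∃[ h ] h ≤ 1 × Δ r (c + (h + 2)) ≡ not (Δ r (c + h))
Δr-flips c with halving c
... | digits f g = toℕ f , toℕ≤1 f , (begin
  Δ r (toℕ f + 2 * g + (toℕ f + 2))  ≡⟨ cong (Δ r) (shift (toℕ f) g) ⟩
  Δ r (2 * suc (g + toℕ f))          ≡⟨ Δr-even (suc (g + toℕ f)) ⟩
  not (oddᵇ (g + toℕ f))             ≡⟨ cong not (Δr-even (g + toℕ f)) ⟨
  not (Δ r (2 * (g + toℕ f)))        ≡⟨ cong (λ n → not (Δ r n)) (round-to-even f g) ⟨
  not (Δ r (toℕ f + 2 * g + toℕ f))  ∎)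
  where
  shift : ∀ a g → a + 2 * g + (a + 2) ≡ 2 * suc (g + a)
  shift = solve-∀

-- Agreement at the offsets 2h, h ≤ 3, would make Δ r constant on c', …, c' + 3.
Δr-agree-even-odd : ∀ c c' → ¬ AgreeOn (Δ r) 7 (2 * c) (suc (2 * c'))
Δr-agree-even-odd c c' agree with Δr-flips c'
... | h , h≤1 , flips = not-¬ (trans (constant (h + 2) (+-monoˡ-≤ 2 h≤1)) (sym (constant h (≤-trans h≤1 (s≤s z≤n))))) flips
  where
  constant : ∀ h → h ≤ 3 → Δ r (c' + h) ≡ oddᵇ c xor oddᵇ c'
  constant h h≤3 = begin
    Δ r (c' + h)                                 ≡⟨ xor-cancel (Δ r (c' + h)) (oddᵇ (c' + h)) ⟨
    (Δ r (c' + h) xor oddᵇ (c' + h)) xor oddᵇ (c' + h)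
      ≡⟨ cong (_xor oddᵇ (c' + h)) (Δr-odd (c' + h)) ⟨
    Δ r (suc (2 * (c' + h))) xor oddᵇ (c' + h)   ≡⟨ cong (λ n → Δ r (suc n) xor oddᵇ (c' + h)) (*-distribˡ-+ 2 c' h) ⟩
    Δ r (suc (2 * c') + 2 * h) xor oddᵇ (c' + h) ≡⟨ cong (_xor oddᵇ (c' + h)) (at agree (2 * h) (s≤s (*-monoʳ-≤ 2 h≤3))) ⟨
    Δ r (2 * c + 2 * h) xor oddᵇ (c' + h)        ≡⟨ cong (λ n → Δ r n xor oddᵇ (c' + h)) (*-distribˡ-+ 2 c h) ⟨
    Δ r (2 * (c + h)) xor oddᵇ (c' + h)          ≡⟨ cong (_xor oddᵇ (c' + h)) (Δr-even (c + h)) ⟩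
    oddᵇ (c + h) xor oddᵇ (c' + h)               ≡⟨ cong₂ _xor_ (oddᵇ-+ c h) (oddᵇ-+ c' h) ⟩
    (oddᵇ c xor oddᵇ h) xor (oddᵇ c' xor oddᵇ h) ≡⟨ cancel₂ (oddᵇ c) (oddᵇ c') (oddᵇ h) ⟩
    oddᵇ c xor oddᵇ c'                           ∎
    where
    cancel₂ : ∀ a b c → (a xor c) xor (b xor c) ≡ a xor b
    cancel₂ = solve 3 (λ a b c → ((a ⊕ c) ⊕ (b ⊕ c)) ⊜ (a ⊕ b)) refl

Δr-agree⇒oddᵇ≡ : ∀ n n' → AgreeOn (Δ r) 7 n n' → oddᵇ n ≡ oddᵇ n'
Δr-agree⇒oddᵇ≡ n n' agree with halving n | halving n'
... | digits false c | digits false c' = trans (oddᵇ-digits false c) (sym (oddᵇ-digits false c'))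
... | digits true  c | digits true  c' = trans (oddᵇ-digits true c) (sym (oddᵇ-digits true c'))
... | digits false c | digits true  c' = ⊥-elim (Δr-agree-even-odd c c' agree)
... | digits true  c | digits false c' = ⊥-elim (Δr-agree-even-odd c' c (agreeing λ i lt → sym (at agree i lt)))

Δr-halves-parity : ∀ e c c' → AgreeOn (Δ r) 2 (toℕ e + 2 * c) (toℕ e + 2 * c') → oddᵇ c ≡ oddᵇ c'
Δr-halves-parity e c c' agree = xor-cancelʳ e (begin
  oddᵇ c xor e                   ≡⟨ cong (oddᵇ c xor_) (oddᵇ-toℕ e) ⟨
  oddᵇ c xor oddᵇ (toℕ e)        ≡⟨ oddᵇ-+ c (toℕ e) ⟨
  oddᵇ (c + toℕ e)               ≡⟨ Δr-even (c + toℕ e) ⟨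
  Δ r (2 * (c + toℕ e))          ≡⟨ cong (Δ r) (round-to-even e c) ⟨
  Δ r (toℕ e + 2 * c + toℕ e)    ≡⟨ at agree (toℕ e) (s≤s (toℕ≤1 e)) ⟩
  Δ r (toℕ e + 2 * c' + toℕ e)   ≡⟨ cong (Δ r) (round-to-even e c') ⟩
  Δ r (2 * (c' + toℕ e))         ≡⟨ Δr-even (c' + toℕ e) ⟩
  oddᵇ (c' + toℕ e)              ≡⟨ oddᵇ-+ c' (toℕ e) ⟩
  oddᵇ c' xor oddᵇ (toℕ e)       ≡⟨ cong (oddᵇ c' xor_) (oddᵇ-toℕ e) ⟩
  oddᵇ c' xor e                  ∎)

odd-position : ∀ e c i → toℕ e + 2 * c + (toℕ (not e) + 2 * i) ≡ suc (2 * (c + i))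
odd-position false c i = trans (+-suc (2 * c) (2 * i)) (cong suc (sym (*-distribˡ-+ 2 c i)))
odd-position true  c i = cong suc (sym (*-distribˡ-+ 2 c i))

Δr-agree-halves : ∀ e c c' L → oddᵇ c ≡ oddᵇ c' → AgreeOn (Δ r) (2 * L) (toℕ e + 2 * c) (toℕ e + 2 * c')
                → AgreeOn (Δ r) L c c'
Δr-agree-halves e c c' L parity agree = agreeing pointwise
  where
  pointwise : ∀ i → i < L → Δ r (c + i) ≡ Δ r (c' + i)
  pointwise i i<L = xor-cancelʳ (oddᵇ (c + i)) (begin
    Δ r (c + i) xor oddᵇ (c + i)                 ≡⟨ Δr-odd (c + i) ⟨
    Δ r (suc (2 * (c + i)))                      ≡⟨ cong (Δ r) (odd-position e c i) ⟨
    Δ r (toℕ e + 2 * c + offset)                 ≡⟨ at agree offset offset<2L ⟩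
    Δ r (toℕ e + 2 * c' + offset)                ≡⟨ cong (Δ r) (odd-position e c' i) ⟩
    Δ r (suc (2 * (c' + i)))                     ≡⟨ Δr-odd (c' + i) ⟩
    Δ r (c' + i) xor oddᵇ (c' + i)               ≡⟨ cong (Δ r (c' + i) xor_) same-parity ⟩
    Δ r (c' + i) xor oddᵇ (c + i)                ∎)
    where
    offset = toℕ (not e) + 2 * i
    offset<2L : offset < 2 * L
    offset<2L = <-≤-trans (digits<2*suc (not e) i) (*-monoʳ-≤ 2 i<L)
    same-parity : oddᵇ (c' + i) ≡ oddᵇ (c + i)
    same-parity = trans (oddᵇ-+ c' i) (trans (cong (_xor oddᵇ i) (sym parity)) (sym (oddᵇ-+ c i)))

_mod2^_ : ℕ → ℕ → ℕ
n mod2^ k = _%_ n (2 ^ k) {{m^n≢0 2 k}}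

mod2^-digits : ∀ e x k → (toℕ e + 2 * x) mod2^ suc k ≡ toℕ e + 2 * (x mod2^ k)
mod2^-digits e x k = begin
  (toℕ e + 2 * x) % 2 ^ suc k                  ≡⟨ cong (λ y → (toℕ e + 2 * y) % 2 ^ suc k) (m≡m%n+[m/n]*n x (2 ^ k)) ⟩
  (toℕ e + 2 * (ρ + q * 2 ^ k)) % 2 ^ suc k    ≡⟨ cong (_% 2 ^ suc k) (regroup (toℕ e) ρ q (2 ^ k)) ⟩
  (toℕ e + 2 * ρ + q * 2 ^ suc k) % 2 ^ suc k  ≡⟨ [m+kn]%n≡m%n (toℕ e + 2 * ρ) q (2 ^ suc k) ⟩
  (toℕ e + 2 * ρ) % 2 ^ suc k                  ≡⟨ m<n⇒m%n≡m (<-≤-trans (digits<2*suc e ρ) (*-monoʳ-≤ 2 (m%n<n x (2 ^ k)))) ⟩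
  toℕ e + 2 * ρ                                ∎
  where
  instance
    2^k≢0 : NonZero (2 ^ k)
    2^k≢0 = m^n≢0 2 k
    2^1+k≢0 : NonZero (2 ^ suc k)
    2^1+k≢0 = m^n≢0 2 (suc k)
  ρ = x % 2 ^ k
  q = x / 2 ^ k
  regroup : ∀ a ρ q M → a + 2 * (ρ + q * M) ≡ a + 2 * ρ + q * (2 * M)
  regroup = solve-∀

mod2^-decompose : ∀ n k → ∃[ q ] n ≡ 2 ^ k * q + n mod2^ k
mod2^-decompose n k =
  n / 2 ^ k , trans (m≡m%n+[m/n]*n n (2 ^ k)) (trans (+-comm (n % 2 ^ k) _) (cong (_+ n % 2 ^ k) (*-comm (n / 2 ^ k) (2 ^ k))))
  where
  instance
    2^k≢0 : NonZero (2 ^ k)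
    2^k≢0 = m^n≢0 2 k

mod2^-block : ∀ k q j → (2 ^ k * q + j) mod2^ k ≡ j mod2^ k
mod2^-block k q j = trans (cong (_% 2 ^ k) (trans (+-comm (2 ^ k * q) j) (cong (j +_) (*-comm (2 ^ k) q)))) ([m+kn]%n≡m%n j q (2 ^ k))
  where
  instance
    2^k≢0 : NonZero (2 ^ k)
    2^k≢0 = m^n≢0 2 k

mod2^-< : ∀ k j → j < 2 ^ k → j mod2^ k ≡ j
mod2^-< k j = m<n⇒m%n≡m {{m^n≢0 2 k}}

mod2^-∣ : ∀ k n n' c → n mod2^ k ≡ n' mod2^ k → 2 ^ k ∣ n' + c → 2 ^ k ∣ n + c
mod2^-∣ k n n' c same divides' = m%n≡0⇒n∣m (n + c) (2 ^ k) (begin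
  (n + c) % 2 ^ k                      ≡⟨ %-distribˡ-+ n c (2 ^ k) ⟩
  (n % 2 ^ k + c % 2 ^ k) % 2 ^ k      ≡⟨ cong (λ x → (x + c % 2 ^ k) % 2 ^ k) same ⟩
  (n' % 2 ^ k + c % 2 ^ k) % 2 ^ k     ≡⟨ %-distribˡ-+ n' c (2 ^ k) ⟨
  (n' + c) % 2 ^ k                     ≡⟨ n∣m⇒m%n≡0 (n' + c) (2 ^ k) divides' ⟩
  0                                    ∎)
  where
  instance
    2^k≢0 : NonZero (2 ^ k)
    2^k≢0 = m^n≢0 2 k

Δr-agree⇒≡mod : ∀ j n n' → oddᵇ n ≡ oddᵇ n' → AgreeOn (Δ r) (2 ^ j) n n' → n mod2^ suc j ≡ n' mod2^ suc j
Δr-agree⇒≡mod j n n' parity agree with halving n | halving n'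
... | digits e c | digits e' c' with trans (sym (oddᵇ-digits e c)) (trans parity (oddᵇ-digits e' c'))
... | refl = begin
  (toℕ e + 2 * c) mod2^ suc j   ≡⟨ mod2^-digits e c j ⟩
  toℕ e + 2 * (c mod2^ j)       ≡⟨ cong (λ z → toℕ e + 2 * z) (halves j agree) ⟩
  toℕ e + 2 * (c' mod2^ j)      ≡⟨ mod2^-digits e c' j ⟨
  (toℕ e + 2 * c') mod2^ suc j  ∎
  where
  halves : ∀ j → AgreeOn (Δ r) (2 ^ j) (toℕ e + 2 * c) (toℕ e + 2 * c') → c mod2^ j ≡ c' mod2^ j
  halves zero    _     = trans (n%1≡0 c) (sym (n%1≡0 c'))
  halves (suc j) agree = Δr-agree⇒≡mod j c c' halves-parity (Δr-agree-halves e c c' (2 ^ j) halves-parity agree)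
    where
    halves-parity : oddᵇ c ≡ oddᵇ c'
    halves-parity = Δr-halves-parity e c c' (agree-≤ (^-monoʳ-≤ 2 {1} {suc j} (s≤s z≤n)) agree)

Δr-sync : ∀ j n n' → 7 ≤ 2 ^ j → AgreeOn (Δ r) (2 ^ j) n n' → n mod2^ suc j ≡ n' mod2^ suc j
Δr-sync j n n' 7≤2^j agree = Δr-agree⇒≡mod j n n' (Δr-agree⇒oddᵇ≡ n n' (agree-≤ 7≤2^j agree)) agree

r-block-low : ∀ t A j → j < 2 ^ t → r (2 ^ suc t * A + j) ≡ r A xor r j
r-block-low t A j lt = begin
  r (2 ^ suc t * A + j)                    ≡⟨ r-block t A j (<-≤-trans lt (^-monoʳ-≤ 2 (n≤1+n t))) ⟩
  (r A xor r j) xor (oddᵇ A ∧ bit t j)     ≡⟨ cong (λ b → (r A xor r j) xor (oddᵇ A ∧ b)) (bit-< t j lt) ⟩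
  (r A xor r j) xor (oddᵇ A ∧ false)       ≡⟨ cong ((r A xor r j) xor_) (∧-zeroʳ (oddᵇ A)) ⟩
  (r A xor r j) xor false                  ≡⟨ xor-identityʳ (r A xor r j) ⟩
  r A xor r j                              ∎

r-block-high : ∀ t A J → 2 ^ t ≤ J → J < 2 ^ suc t → r (2 ^ suc t * A + J) ≡ (r A xor r J) xor oddᵇ A
r-block-high t A J le lt = begin
  r (2 ^ suc t * A + J)                    ≡⟨ r-block t A J lt ⟩
  (r A xor r J) xor (oddᵇ A ∧ bit t J)     ≡⟨ cong (λ b → (r A xor r J) xor (oddᵇ A ∧ b)) (bit-≥ t J le lt) ⟩
  (r A xor r J) xor (oddᵇ A ∧ true)        ≡⟨ cong ((r A xor r J) xor_) (∧-identityʳ (oddᵇ A)) ⟩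
  (r A xor r J) xor oddᵇ A                 ∎

block-index-parity : ∀ t A B j J → j < 2 ^ t → 2 ^ t ≤ J → J < 2 ^ suc t
                   → r (2 ^ suc t * A + j) ≡ r (2 ^ suc t * B + j) → r (2 ^ suc t * A + J) ≡ r (2 ^ suc t * B + J)
                   → oddᵇ A ≡ oddᵇ B
block-index-parity t A B j J j<2^t 2^t≤J J<2^1+t low high = xor-cancelˡ (r A xor r J) (begin
  (r A xor r J) xor oddᵇ A   ≡⟨ r-block-high t A J 2^t≤J J<2^1+t ⟨
  r (2 ^ suc t * A + J)      ≡⟨ high ⟩
  r (2 ^ suc t * B + J)      ≡⟨ r-block-high t B J 2^t≤J J<2^1+t ⟩
  (r B xor r J) xor oddᵇ B   ≡⟨ cong (λ a → (a xor r J) xor oddᵇ B) same-r ⟨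
  (r A xor r J) xor oddᵇ B   ∎)
  where
  same-r : r A ≡ r B
  same-r = xor-cancelʳ (r j) (trans (sym (r-block-low t A j j<2^t)) (trans low (r-block-low t B j j<2^t)))
  xor-cancelˡ : ∀ {a b} c → c xor a ≡ c xor b → a ≡ b
  xor-cancelˡ {a} {b} c eq = xor-cancelʳ c (trans (xor-comm a c) (trans eq (xor-comm c b)))

block-≡mod : ∀ k A B j → oddᵇ A ≡ oddᵇ B → (2 ^ k * A + j) mod2^ suc k ≡ (2 ^ k * B + j) mod2^ suc k
block-≡mod k A B j parity with halving A | halving B
... | digits e a | digits e' b with trans (sym (oddᵇ-digits e a)) (trans parity (oddᵇ-digits e' b))
... | refl = trans (reduce a) (sym (reduce b))
  where
  regroup : ∀ P e a j → P * (e + 2 * a) + j ≡ (P * e + j) + a * (2 * P)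
  regroup = solve-∀
  reduce : ∀ a → (2 ^ k * (toℕ e + 2 * a) + j) mod2^ suc k ≡ (2 ^ k * toℕ e + j) mod2^ suc k
  reduce a = trans (cong (_mod2^ suc k) (regroup (2 ^ k) (toℕ e) a j))
                   ([m+kn]%n≡m%n (2 ^ k * toℕ e + j) a (2 ^ suc k) {{m^n≢0 2 (suc k)}})

<-complement : ∀ {j L M} → j + L ≤ M + M → M < L → j < M
<-complement {j} {L} {M} fits long =
  +-cancelʳ-≤ M (suc j) M (≤-trans (subst (_≤ j + L) (+-suc j M) (+-monoʳ-≤ j long)) fits)

aligned-residue : ∀ t → 3 ≤ t → ∀ A j L n → 2 ^ t < L → j + L ≤ 2 ^ suc t
                → AgreeOn r L (2 ^ suc t * A + j) n → n mod2^ suc t ≡ j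
aligned-residue t 3≤t A j (suc L) n long fits agree = begin
  n mod2^ suc t                    ≡⟨ Δr-sync t (2 ^ suc t * A + j) n 7≤2^t (agree-≤ (≤-pred long) (agree-Δ agree)) ⟨
  (2 ^ suc t * A + j) mod2^ suc t  ≡⟨ mod2^-block (suc t) A j ⟩
  j mod2^ suc t                    ≡⟨ mod2^-< (suc t) j (<-≤-trans (m<m+n j z<s) fits) ⟩
  j                                ∎
  where
  7≤2^t : 7 ≤ 2 ^ t
  7≤2^t = ≤-trans (n≤1+n 7) (^-monoʳ-≤ 2 3≤t)

aligned-≡mod : ∀ t → 3 ≤ t → ∀ A j L n → 2 ^ t < L → j + L ≤ 2 ^ suc t
             → AgreeOn r L (2 ^ suc t * A + j) n → n mod2^ suc (suc t) ≡ (2 ^ suc t * A + j) mod2^ suc (suc t)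
aligned-≡mod t 3≤t A j (suc L) n long fits agree = begin
  n mod2^ suc (suc t)              ≡⟨ cong (_mod2^ suc (suc t)) n≡Pq+j ⟩
  (P * q + j) mod2^ suc (suc t)    ≡⟨ block-≡mod (suc t) q A j (sym parity) ⟩
  (P * A + j) mod2^ suc (suc t)    ∎
  where
  P = 2 ^ suc t
  q = proj₁ (mod2^-decompose n (suc t))
  n≡Pq+j : n ≡ P * q + j
  n≡Pq+j = trans (proj₂ (mod2^-decompose n (suc t))) (cong (P * q +_) (aligned-residue t 3≤t A j (suc L) n long fits agree))
  agree-blocks : ∀ i → i < suc L → r (P * A + (j + i)) ≡ r (P * q + (j + i))
  agree-blocks i lt = begin
    r (P * A + (j + i))  ≡⟨ cong r (+-assoc (P * A) j i) ⟨
    r (P * A + j + i)    ≡⟨ at agree i lt ⟩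
    r (n + i)            ≡⟨ cong (λ m → r (m + i)) n≡Pq+j ⟩
    r (P * q + j + i)    ≡⟨ cong r (+-assoc (P * q) j i) ⟩
    r (P * q + (j + i))  ∎
  j<2^t : j + 0 < 2 ^ t
  j<2^t = subst (_< 2 ^ t) (sym (+-identityʳ j))
                (<-complement (subst (j + suc L ≤_) (cong (2 ^ t +_) (+-identityʳ (2 ^ t))) fits) long)
  parity : oddᵇ A ≡ oddᵇ q
  parity = block-index-parity t A q (j + 0) (j + L) j<2^t
             (≤-trans (≤-pred long) (m≤n+m L j)) (<-≤-trans (+-monoʳ-< j (n<1+n L)) fits)
             (agree-blocks 0 z<s) (agree-blocks L (n<1+n L))

occurrence-positions-divisible : ∀ t → 3 ≤ t → ∀ w → 2 ^ t + 1 ≤ length w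
  → SubwordOfAlignedBlock (2 ^ (t + 1)) w r
  → ∀ n m → OccursAt r w n → OccursAt s (reverse w) m → 2 ^ (t + 2) ∣ n + m + length w
occurrence-positions-divisible t 3≤t w long (A , j , fits , occ₀) n m occ occˢ =
  subst (λ k → 2 ^ k ∣ n + m + L) (+-comm 2 t) (subst (2 ^ suc (suc t) ∣_) (sym (+-assoc n m L)) n-sum)
  where
  L = length w
  t+1≡1+t : t + 1 ≡ suc t
  t+1≡1+t = +-comm t 1
  n₀ = 2 ^ suc t * A + j
  ≡n₀ : ∀ n → OccursAt r w n → n mod2^ suc (suc t) ≡ n₀ mod2^ suc (suc t)
  ≡n₀ n occ = aligned-≡mod t 3≤t A j L n (subst (_≤ L) (+-comm (2 ^ t) 1) long)
               (subst (λ k → j + L ≤ 2 ^ k) t+1≡1+t fits)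
               (occurrences-agree (subst (λ k → OccursAt r w (2 ^ k * A + j)) t+1≡1+t occ₀) occ)
  reflected = s-factor-in-r m L (suc (suc t))
  n' = proj₁ reflected
  n'-occ : OccursAt r w n'
  n'-occ = reverse-occurs⁻¹ occˢ (proj₁ (proj₂ reflected))
  n'-sum : 2 ^ suc (suc t) ∣ n' + (m + L)
  n'-sum = subst (2 ^ suc (suc t) ∣_) (+-assoc n' m L) (proj₂ (proj₂ reflected))
  n-sum : 2 ^ suc (suc t) ∣ n + (m + L)
  n-sum = mod2^-∣ (suc (suc t)) n n₀ (m + L) (≡n₀ n occ)
            (mod2^-∣ (suc (suc t)) n₀ n' (m + L) (sym (≡n₀ n' n'-occ)) n'-sum)

lemma4p5 : ((w : List Bool) → IsSubword w r ⇔ IsSubword (reverse w) s)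
           × ((t : ℕ) → 3 ≤ t → (w : List Bool) → 2 ^ t + 1 ≤ length w
              → SubwordOfAlignedBlock (2 ^ (t + 1)) w r
              → (n m : ℕ) → OccursAt r w n → OccursAt s (reverse w) m
              → 2 ^ (t + 2) ∣ n + m + length w)
lemma4p5 = subword-r⇔reverse-subword-s , occurrence-positions-divisible
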